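{- Let $\mathcal{L}=(\mathcal{S},\mathcal{A},(\xrightarrow{a})_{a\in\mathcal{A}})$ be an image-finite LTS and $t\in\mathcal{S}$. If an infinite path $s_0\xrightarrow{a_1}s_1\xrightarrow{a_2}s_2\xrightarrow{a_3}\cdots$ satisfies that for every $e\in\mathbb{N}$ there is $i$ with $e<\mathrm{EqL}(s_i,t)<\omega$, then the set $\{[s_i]\mid i\in\mathbb{N}\}$ is infinite (the path is bisim-infinite), and hence, if $\mathcal{A}$ is finite, $s_0$ is non-regular.
   Context: An LTS is image-finite if $\{s'\mid s\xrightarrow{a}s'\}$ is finite for all $s$ and $a$. Say that $\mathcal{B}\subseteq\mathcal{S}\times\mathcal{S}$ covers $(s,t)$ if every $s\xrightarrow{a}s'$ has some $t\xrightarrow{a}t'$ with $(s',t')\in\mathcal{B}$ and every $t\xrightarrow{a}t'$ has some $s\xrightarrow{a}s'$ with $(s',t')\in\mathcal{B}$. A bisimulation is a relation covering all its pairs; $\sim$ is the union of all bisimulations, and $[s]=\{s'\mid s'\sim s\}$. Put $\sim_0=\mathcal{S}\times\mathcal{S}$ and let $\sim_{k+1}$ be the set of pairs covered by $\sim_k$. The equivalence level is $\mathrm{EqL}(s,t)=k\in\mathbb{N}$ if $s\sim_k t$ and $s\not\sim_{k+1}t$, and $\mathrm{EqL}(s,t)=\omega$ if $s\sim t$ (where $n<\omega$ for all $n\in\mathbb{N}$). A state $s_0$ is regular if the set of classes $[s]$ of states $s$ reachable from $s_0$ is finite, and non-regular otherwise. -}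

module Defs where

open import Data.Unit using (⊤)
open import Data.Nat using (ℕ; zero; suc; _<_)
open import Data.Product using (Σ; ∃; ∃-syntax; _×_; _,_)
open import Data.List using (List)
open import Data.List.Membership.Propositional using (_∈_)
open import Relation.Nullary using (¬_)
open import Relation.Binary.Construct.Closure.ReflexiveTransitive using (Star)

record LTS : Set₁ where
  field
    S    : Set
    A    : Set
    _⟶[_]_ : S → A → S → Set

module _ (L : LTS) where
  open LTS L

  ImageFinite : Set
  ImageFinite = ∀ (s : S) (a : A) →
    Σ (List S) λ l → ∀ s' → ((s ⟶[ a ] s') → s' ∈ l) × (s' ∈ l → s ⟶[ a ] s')

  Covers : (S → S → Set) → S → S → Set
  Covers B s t =
    (∀ a s' → s ⟶[ a ] s' → ∃[ t' ] (t ⟶[ a ] t' × B s' t')) ×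
    (∀ a t' → t ⟶[ a ] t' → ∃[ s' ] (s ⟶[ a ] s' × B s' t'))

  IsBisimulation : (S → S → Set) → Set
  IsBisimulation B = ∀ s t → B s t → Covers B s t

  _∼_ : S → S → Set₁
  s ∼ t = Σ (S → S → Set) λ B → IsBisimulation B × B s t


  _∼[_]_ : S → ℕ → S → Set
  s ∼[ zero ]  t = ⊤
  s ∼[ suc k ] t = Covers (λ s' t' → s' ∼[ k ] t') s t

  -- EqL(s,t) = k  for finite k ∈ ℕ
  EqL≡ : S → S → ℕ → Set
  EqL≡ s t k = (s ∼[ k ] t) × ¬ (s ∼[ suc k ] t)

  Step : S → S → Set
  Step s s' = ∃[ a ] (s ⟶[ a ] s')

  Reachable : S → S → Set
  Reachable = Star Step

  -- s0 is regular: the set {[s] | s reachable from s0} is finite,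
  -- i.e. exactly enumerated by a finite list of representatives.
  Regular : S → Set₁
  Regular s0 = Σ (List S) λ l →
    (∀ s → Reachable s0 s → ∃[ u ] (u ∈ l × s ∼ u)) ×
    (∀ u → u ∈ l → ∃[ s ] (Reachable s0 s × s ∼ u))

  FiniteClassesOf : (ℕ → S) → Set₁
  FiniteClassesOf p = Σ (List S) λ l →
    (∀ i → ∃[ u ] (u ∈ l × p i ∼ u)) ×
    (∀ u → u ∈ l → ∃[ i ] (p i ∼ u))

  FiniteActions : Set
  FiniteActions = Σ (List A) λ l → ∀ a → a ∈ l

-- Whether x ∼[ k ] t holds for the next k is a property of the class [x], so each class has at
-- most one finite equivalence level with t. Finitely many classes along the path would
-- therefore bound the levels EqL(sᵢ, t) < ω, contradicting their unboundedness. Every sᵢ is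
-- reachable from s₀, so a regular s₀ would give finitely many classes as well.
module Submission where

open import Defs hiding (_∼[_]_; _∼_)
import Defs
open import Data.Nat using (ℕ; zero; suc; _<_; _≤_; s≤s; _⊔_)
open import Data.Nat.Properties using (<-cmp; <⇒≢; ≤-<-trans; m≤m⊔n; m≤n⊔m)
open import Data.Product using (∃-syntax; _×_; _,_)
open import Data.Unit using (tt)
open import Data.Empty using (⊥; ⊥-elim)
open import Data.List using (List; []; _∷_)
open import Data.List.Relation.Unary.Any using (here; there)
open import Data.List.Membership.Propositional using (_∈_)
open import Relation.Binary.Definitions using (tri<; tri≈; tri>)
open import Relation.Binary.PropositionalEquality using (_≡_; refl)
open import Relation.Binary.Construct.Closure.ReflexiveTransitive using (ε; _◅_; _◅◅_)
open import Relation.Nullary using (¬_; yes; no)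
open import Relation.Nullary.Decidable using (¬¬-excluded-middle)

module _ {X : Set} (R : X → ℕ → Set) where

  Unbounded : List X → Set
  Unbounded l = ∀ e → ∃[ u ] ∃[ k ] (u ∈ l × e < k × R u k)

  Functional : Set
  Functional = ∀ {x j k} → R x j → R x k → j ≡ k

  Unbounded-∷⁻ : ∀ {x} {xs} b → (∀ k → b < k → ¬ R x k) →
                 Unbounded (x ∷ xs) → Unbounded xs
  Unbounded-∷⁻ b x-bounded unb e with unb (e ⊔ b)
  ... | _ , k , here refl , e⊔b<k , Rxk =
    ⊥-elim (x-bounded k (≤-<-trans (m≤n⊔m e b) e⊔b<k) Rxk)
  ... | u , k , there u∈xs , e⊔b<k , Ruk =
    u , k , u∈xs , ≤-<-trans (m≤m⊔n e b) e⊔b<k , Ruk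

  -- Excluded middle on "x has an R-value" is admissible here because the goal is ⊥.
  ¬Unbounded : Functional → ∀ l → ¬ Unbounded l
  ¬Unbounded _ [] unb with unb 0
  ... | _ , _ , () , _
  ¬Unbounded functional (x ∷ xs) unb = ¬¬-excluded-middle {A = ∃[ k ] R x k} λ where
    (yes (k₀ , Rxk₀)) → ¬Unbounded functional xs
      (Unbounded-∷⁻ {x} k₀ (λ k k₀<k Rxk → <⇒≢ k₀<k (functional Rxk₀ Rxk)) unb)
    (no ¬Rx) → ¬Unbounded functional xs
      (Unbounded-∷⁻ {x} 0 (λ k _ Rxk → ¬Rx (k , Rxk)) unb)

module _ (L : LTS) where
  open LTS L

  infix 4 _∼[_]_ _∼_

  _∼[_]_ : S → ℕ → S → Set
  _∼[_]_ = Defs._∼[_]_ L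

  _∼_ : S → S → Set₁
  _∼_ = Defs._∼_ L

  Covers-map : ∀ {B B′ : S → S → Set} → (∀ {x y} → B x y → B′ x y) →
               ∀ {x y} → Covers L B x y → Covers L B′ x y
  Covers-map f (forth , back) =
    (λ a x′ x⟶x′ → let y′ , y⟶y′ , b = forth a x′ x⟶x′ in y′ , y⟶y′ , f b) ,
    (λ a y′ y⟶y′ → let x′ , x⟶x′ , b = back a y′ y⟶y′ in x′ , x⟶x′ , f b)

  ∼[]-antitone : ∀ {j k x y} → j ≤ k → x ∼[ k ] y → x ∼[ j ] y
  ∼[]-antitone {zero}  _         _   = tt
  ∼[]-antitone {suc j} (s≤s j≤k) x∼y = Covers-map (∼[]-antitone j≤k) x∼y

  ∼[]-sym : ∀ k {x y} → x ∼[ k ] y → y ∼[ k ] x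
  ∼[]-sym zero    _              = tt
  ∼[]-sym (suc k) (forth , back) =
    (λ a y′ y⟶y′ → let x′ , x⟶x′ , r = back a y′ y⟶y′ in x′ , x⟶x′ , ∼[]-sym k r) ,
    (λ a x′ x⟶x′ → let y′ , y⟶y′ , r = forth a x′ x⟶x′ in y′ , y⟶y′ , ∼[]-sym k r)

  ∼[]-trans : ∀ k {x y z} → x ∼[ k ] y → y ∼[ k ] z → x ∼[ k ] z
  ∼[]-trans zero    _                _                = tt
  ∼[]-trans (suc k) (forth₁ , back₁) (forth₂ , back₂) =
    (λ a x′ x⟶x′ → let y′ , y⟶y′ , r₁ = forth₁ a x′ x⟶x′
                       z′ , z⟶z′ , r₂ = forth₂ a y′ y⟶y′
                    in z′ , z⟶z′ , ∼[]-trans k r₁ r₂) ,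
    (λ a z′ z⟶z′ → let y′ , y⟶y′ , r₂ = back₂ a z′ z⟶z′
                       x′ , x⟶x′ , r₁ = back₁ a y′ y⟶y′
                    in x′ , x⟶x′ , ∼[]-trans k r₁ r₂)

  ∼⇒∼[] : ∀ k {x y} → x ∼ y → x ∼[ k ] y
  ∼⇒∼[] k (B , isBisim , Bxy) = B⇒∼[] k Bxy
    where
    B⇒∼[] : ∀ k {x y} → B x y → x ∼[ k ] y
    B⇒∼[] zero    _   = tt
    B⇒∼[] (suc k) Bxy = Covers-map (B⇒∼[] k) (isBisim _ _ Bxy)

  EqL≡-functional : ∀ t → Functional (λ x k → EqL≡ L x t k)
  EqL≡-functional t {j = j} {k} (x∼[j]t , x≁[1+j]t) (x∼[k]t , x≁[1+k]t) with <-cmp j k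
  ... | tri< j<k _ _ = ⊥-elim (x≁[1+j]t (∼[]-antitone j<k x∼[k]t))
  ... | tri≈ _ j≡k _ = j≡k
  ... | tri> _ _ k<j = ⊥-elim (x≁[1+k]t (∼[]-antitone k<j x∼[j]t))

  EqL≡-respˡ-∼ : ∀ {x u t k} → x ∼ u → EqL≡ L x t k → EqL≡ L u t k
  EqL≡-respˡ-∼ {k = k} x∼u (x∼[k]t , x≁[1+k]t) =
    ∼[]-trans k (∼[]-sym k (∼⇒∼[] k x∼u)) x∼[k]t ,
    λ u∼[1+k]t → x≁[1+k]t (∼[]-trans (suc k) (∼⇒∼[] (suc k) x∼u) u∼[1+k]t)

  ¬finite-cover-of-unbounded-EqL : ∀ t (p : ℕ → S) →
    (∀ e → ∃[ i ] ∃[ k ] (e < k × EqL≡ L (p i) t k)) →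
    (l : List S) → ¬ (∀ i → ∃[ u ] (u ∈ l × p i ∼ u))
  ¬finite-cover-of-unbounded-EqL t p unbounded l covers =
    ¬Unbounded (λ x k → EqL≡ L x t k) (EqL≡-functional t) l λ e →
      let i , k , e<k , eqL = unbounded e
          u , u∈l , pᵢ∼u    = covers i
      in u , k , u∈l , e<k , EqL≡-respˡ-∼ pᵢ∼u eqL

  path-reachable : (p : ℕ → S) (a : ℕ → A) → (∀ i → p i ⟶[ a (suc i) ] p (suc i)) →
                   ∀ i → Reachable L (p 0) (p i)
  path-reachable p a step zero    = ε
  path-reachable p a step (suc i) = path-reachable p a step i ◅◅ ((a (suc i) , step i) ◅ ε)

proposition4 : (L : LTS) → ImageFinite L → (t : LTS.S L) →
    (s : ℕ → LTS.S L) → (a : ℕ → LTS.A L) →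
    (∀ i → LTS._⟶[_]_ L (s i) (a (suc i)) (s (suc i))) →
    (∀ (e : ℕ) → ∃[ i ] ∃[ k ] (e < k × EqL≡ L (s i) t k)) →
    ¬ FiniteClassesOf L s × (FiniteActions L → ¬ Regular L (s 0))
proposition4 L _ t s a step unbounded =
  (λ (l , covers , _) → ¬finite-cover l covers) ,
  (λ _ (l , covers , _) → ¬finite-cover l λ i → covers (s i) (path-reachable L s a step i))
  where
  ¬finite-cover : (l : List (LTS.S L)) → ¬ (∀ i → ∃[ u ] (u ∈ l × _∼_ L (s i) u))
  ¬finite-cover = ¬finite-cover-of-unbounded-EqL L t s unbounded
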